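{- Let $\pi=\pi_1\cdots\pi_n$ be a permutation with positive entries, let its right-to-left maxima be $\pi_{i_1}>\cdots>\pi_{i_r}$ (so $i_1<\cdots<i_r$), set $i_0=0$, and let $\mathscr B_\ell(\pi)=\{\pi_i:i_{\ell-1}<i\le i_\ell\}$ for $1\le\ell\le r$. For $1\le m\le r-1$ let $\mathscr E_m(\pi)=\bigcup_{i=m+1}^r\mathscr B_i(\pi)$. If $\mathscr E_m(\pi)$ is quarantined, i.e. $|\mathscr B_m(\pi)|\ge|\mathscr E_m(\pi)|$ and for every $1\le j\le|\mathscr E_m(\pi)|$ the $j$-th largest element of $\mathscr B_m(\pi)$ is greater than the $j$-th largest element of $\mathscr E_m(\pi)$, then $\operatorname{sd}'(\pi)\le i_m$.
   Context: The stack-sorting map $s$ acts on permutations (orderings of finite sets of integers, in one-line notation): $s$ of the empty permutation is empty, and if $\pi=LmR$ with $m$ the largest entry, then $s(\pi)=s(L)s(R)m$; $s^t$ is its $t$-fold iterate. A right-to-left maximum of $\pi$ is an entry $\pi_i$ with $\pi_i>\pi_j$ for all $j>i$. For $\pi$ with positive entries, $\pi0$ is $\pi$ followed by a new entry $0$, and $\operatorname{sd}'(\pi)$ is the smallest positive integer $t$ such that $0$ is the first entry of $s^t(\pi0)$. -}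

module Defs where

open import Data.Nat using (ℕ; zero; suc; _⊔_; _<_; _<?_; _≟_; _∸_)
open import Data.Nat.Properties using (≤-decTotalOrder)
open import Data.List using (List; []; _∷_; _++_; [_]; length; foldr; take; drop; reverse; concat; map; upTo)
open import Data.List.Relation.Unary.All using (all?)
open import Data.Product using (_×_; _,_)
open import Data.Bool using (if_then_else_)
open import Relation.Nullary using (yes; no)
open import Relation.Nullary.Decidable using (⌊_⌋)
open import Function using (_∘_)
import Data.List.Sort.InsertionSort as IS

-- Permutations are lists of naturals (one-line notation); distinctness and
-- positivity are imposed as hypotheses in the statement.

splitAt≡ : ℕ → List ℕ → List ℕ × List ℕ
splitAt≡ m [] = [] , []
splitAt≡ m (x ∷ xs) with x ≟ m
... | yes _ = [] , xs
... | no _ with splitAt≡ m xs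
...   | L , R = x ∷ L , R

-- Stack-sorting map s, by the recursion s(LmR) = s(L) s(R) m (m the largest
-- entry). Fuel (length of the list) ensures termination; it is always enough.
sFuel : ℕ → List ℕ → List ℕ
sFuel _ [] = []
sFuel zero (x ∷ xs) = x ∷ xs
sFuel (suc k) (x ∷ xs) with foldr _⊔_ x xs
... | m with splitAt≡ m (x ∷ xs)
...   | L , R = sFuel k L ++ sFuel k R ++ [ m ]

s : List ℕ → List ℕ
s π = sFuel (length π) π

sIter : ℕ → List ℕ → List ℕ
sIter zero π = π
sIter (suc t) π = s (sIter t π)

-- 1-based positions of the right-to-left maxima (increasing), offset k
rlPosFrom : ℕ → List ℕ → List ℕ
rlPosFrom k [] = []
rlPosFrom k (x ∷ xs) =
  if ⌊ all? (_<? x) xs ⌋ then suc k ∷ rlPosFrom (suc k) xs else rlPosFrom (suc k) xs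

rlPos : List ℕ → List ℕ
rlPos π = rlPosFrom 0 π

numRL : List ℕ → ℕ
numRL π = length (rlPos π)

-- ℓ-th element of a list, 0-based, default 0
at : List ℕ → ℕ → ℕ
at [] _ = 0
at (x ∷ xs) zero = x
at (x ∷ xs) (suc j) = at xs j

-- i_ℓ  (with i_0 = 0, and i_ℓ for 1 ≤ ℓ ≤ r the position of the ℓ-th RL maximum)
idx : List ℕ → ℕ → ℕ
idx π zero = 0
idx π (suc ℓ) = at (rlPos π) ℓ

block : List ℕ → ℕ → List ℕ
block π ℓ = drop (idx π (ℓ ∸ 1)) (take (idx π ℓ) π)

Eset : List ℕ → ℕ → List ℕ
Eset π m = concat (map (λ j → block π (suc m + j)) (upTo (numRL π ∸ m)))
  where open Data.Nat using (_+_)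

-- entries in decreasing order; the j-th largest (1 ≤ j) is  at (sortDesc X) (j ∸ 1)
sortDesc : List ℕ → List ℕ
sortDesc X = reverse (IS.sort ≤-decTotalOrder X)

Quarantined : List ℕ → List ℕ → Set
Quarantined B X =
  (length X Data.Nat.≤ length B) ×
  (∀ j → 1 Data.Nat.≤ j → j Data.Nat.≤ length X →
     at (sortDesc X) (j ∸ 1) < at (sortDesc B) (j ∸ 1))

module Submission where

-- Let f(π) be s(π) without its trailing right-to-left maxima: f [] = [] and
-- f(L n R) = s(L) f(R) for n the first maximum.  For a new entry 0 below all others,
-- s^t(π 0) = f^t(π) 0 D, so 0 is the first entry as soon as f^t(π) = [].
-- Write π = X B E with B = B_m(π), which ends in its maximum, and E = E_m(π).  Quarantine
-- makes B dominate E: for every v, E has at most as many entries ≥ v as B has > v.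
-- One application of f turns X B E into X′ B′ f(E), where B′ again ends in its maximum
-- and dominates f(E), and |X′| + |B′| < |X| + |B|.  Hence f^t(π) = [] for t = i_m = |X| + |B|.

open import Defs
open import Data.Nat using (ℕ; zero; suc; _+_; _≤_; _<_; _⊔_; _≟_; _≤?_; _<?_; _∸_; z≤n; z<s; s≤s; s≤s⁻¹)
open import Data.Nat.Properties
open import Data.Bool using (true; false)
open import Data.List using (List; []; _∷_; _++_; [_]; length; foldr; head; filter; reverse; map; take; drop; concat; upTo)
open import Data.List.Properties
  using (length-++; ++-assoc; foldr-preservesᵇ; foldr-preservesᵒ; filter-++; filter-all; filter-none;
         filter-accept; filter-reject; filter-some; length-filter; unfold-reverse; length-map; map-cong;
         map-applyUpTo; drop-[])
open import Data.List.Relation.Unary.All as All using (All; []; _∷_; all?)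
open import Data.List.Relation.Unary.All.Properties using (++⁺; ++⁻; ++⁻ˡ; ++⁻ʳ)
open import Data.List.Relation.Unary.Any as Any using (here; there)
open import Data.List.Relation.Unary.AllPairs using (AllPairs; []; _∷_)
import Data.List.Relation.Unary.AllPairs.Properties as AllPairs
open import Data.List.Relation.Unary.Linked.Properties using (Linked⇒AllPairs)
open import Data.List.Relation.Unary.Unique.Propositional using (Unique)
open import Data.List.Membership.Propositional using (_∈_)
open import Data.List.Relation.Binary.Permutation.Propositional using (_↭_; ↭-refl; ↭-trans; ↭-sym; prep; ↭⇒↭ₛ)
open import Data.List.Relation.Binary.Permutation.Propositional.Properties
  using (++⁺ʳ; ++-comm; shift; ↭-length; All-resp-↭; filter-↭; ↭-reverse) renaming (++⁺ to ↭-++⁺)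
import Data.List.Relation.Binary.Permutation.Setoid.Properties as PermSetoid
import Data.List.Sort.InsertionSort.Properties as InsertionSort
open import Data.Product using (Σ; _×_; _,_)
open import Data.Sum using (_⊎_; inj₁; inj₂)
open import Data.Empty using (⊥-elim)
open import Data.Maybe using (just)
open import Function using (_∘_; id)
open import Relation.Nullary using (yes; no; ¬_)
open import Relation.Nullary.Decidable using (⌊_⌋)
open import Relation.Unary using (Decidable)
open import Relation.Binary.PropositionalEquality hiding ([_])

record Split (Q : List ℕ → ℕ → List ℕ → Set) (π : List ℕ) : Set where
  constructor split
  field
    left  : List ℕ
    pivot : ℕ
    right : List ℕ
    shape : π ≡ left ++ pivot ∷ right
    cond  : Q left pivot right

AtFirstMax : List ℕ → ℕ → List ℕ → Set
AtFirstMax L n R = All (_< n) L × All (_≤ n) R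

AtLastMax : List ℕ → ℕ → List ℕ → Set
AtLastMax L n R = All (_≤ n) L × All (_< n) R

bounded-around : ∀ {n} L R → All (_≤ n) L → All (_≤ n) R → All (_≤ n) (L ++ n ∷ R)
bounded-around L R L≤ R≤ = ++⁺ L≤ (≤-refl ∷ R≤)

firstMax : ∀ x xs → Split AtFirstMax (x ∷ xs)
firstMax x [] = split [] x [] refl ([] , [])
firstMax x (y ∷ ys) with firstMax y ys
... | split L n R eq (L< , R≤) with n ≤? x
...   | yes n≤x = split [] x (y ∷ ys) refl ([] , All.map (λ p → ≤-trans p n≤x) ys≤n)
  where
  ys≤n : All (_≤ n) (y ∷ ys)
  ys≤n = subst (All (_≤ n)) (sym eq) (bounded-around L R (All.map <⇒≤ L<) R≤)
...   | no n≰x = split (x ∷ L) n R (cong (x ∷_) eq) (≰⇒> n≰x ∷ L< , R≤)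

lastMax : ∀ x xs → Split AtLastMax (x ∷ xs)
lastMax x [] = split [] x [] refl ([] , [])
lastMax x (y ∷ ys) with lastMax y ys
... | split L n R eq (L≤ , R<) with x ≤? n
...   | yes x≤n = split (x ∷ L) n R (cong (x ∷_) eq) (x≤n ∷ L≤ , R<)
...   | no x≰n = split [] x (y ∷ ys) refl ([] , All.map (λ p → ≤-<-trans p (≰⇒> x≰n)) ys≤n)
  where
  ys≤n : All (_≤ n) (y ∷ ys)
  ys≤n = subst (All (_≤ n)) (sym eq) (bounded-around L R L≤ (All.map <⇒≤ R<))

length-around : ∀ (L : List ℕ) n R → length (L ++ n ∷ R) ≡ suc (length L + length R)
length-around [] n R = refl
length-around (l ∷ L) n R = cong suc (length-around L n R)

fuel-around : ∀ {k} L n R → length (L ++ n ∷ R) ≤ k →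
  Σ ℕ λ k′ → k ≡ suc k′ × length L ≤ k′ × length R ≤ k′
fuel-around {k} L n R bound with subst (_≤ k) (length-around L n R) bound
... | s≤s sum≤ = _ , refl , ≤-trans (m≤m+n _ _) sum≤ , ≤-trans (m≤n+m _ _) sum≤

split-induction : ∀ {Q} → (∀ x xs → Split Q (x ∷ xs)) → (P : List ℕ → Set) → P [] →
  (∀ L n R → Q L n R → P L → P R → P (L ++ n ∷ R)) → ∀ π → P π
split-induction {Q} splitter P nil step π = go (length π) π ≤-refl
  where
  go : ∀ k π → length π ≤ k → P π
  go _ [] _ = nil
  go k (x ∷ xs) bound with splitter x xs
  ... | split L n R eq q with fuel-around L n R (subst (λ π → length π ≤ k) eq bound)
  ...   | k′ , refl , L≤k′ , R≤k′ = subst P (sym eq) (step L n R q (go k′ L L≤k′) (go k′ R R≤k′))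

foldr-⊔-attains : ∀ {n} x xs → All (_≤ n) (x ∷ xs) → n ∈ x ∷ xs → foldr _⊔_ x xs ≡ n
foldr-⊔-attains {n} x xs (x≤n ∷ xs≤n) n∈ =
  ≤-antisym (foldr-preservesᵇ ⊔-lub x≤n xs≤n) (foldr-preservesᵒ grows x xs (found n∈))
  where
  grows : ∀ a b → n ≤ a ⊎ n ≤ b → n ≤ a ⊔ b
  grows a b (inj₁ n≤a) = m≤n⇒m≤n⊔o b n≤a
  grows a b (inj₂ n≤b) = m≤n⇒m≤o⊔n a n≤b
  found : n ∈ x ∷ xs → n ≤ x ⊎ Any.Any (n ≤_) xs
  found (here refl) = inj₁ ≤-refl
  found (there n∈xs) = inj₂ (Any.map (λ { refl → ≤-refl }) n∈xs)

∈-around : ∀ (L : List ℕ) n R → n ∈ L ++ n ∷ R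
∈-around [] n R = here refl
∈-around (l ∷ L) n R = there (∈-around L n R)

splitAt≡-around : ∀ n L R → All (_< n) L → splitAt≡ n (L ++ n ∷ R) ≡ (L , R)
splitAt≡-around n [] R _ with n ≟ n
... | yes _ = refl
... | no n≢n = ⊥-elim (n≢n refl)
splitAt≡-around n (l ∷ L) R (l<n ∷ L<) with l ≟ n
... | yes refl = ⊥-elim (<-irrefl refl l<n)
... | no _ rewrite splitAt≡-around n L R L< = refl

firstMax-computed : ∀ {x xs} L n R → x ∷ xs ≡ L ++ n ∷ R → AtFirstMax L n R →
  foldr _⊔_ x xs ≡ n × splitAt≡ n (x ∷ xs) ≡ (L , R)
firstMax-computed {x} {xs} L n R eq (L< , R≤) =
  foldr-⊔-attains x xs (subst (All (_≤ n)) (sym eq) (bounded-around L R (All.map <⇒≤ L<) R≤))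
                       (subst (n ∈_) (sym eq) (∈-around L n R)) ,
  trans (cong (splitAt≡ n) eq) (splitAt≡-around n L R L<)

sFuel-at : ∀ k {x xs} L n R → x ∷ xs ≡ L ++ n ∷ R → AtFirstMax L n R →
  sFuel (suc k) (x ∷ xs) ≡ sFuel k L ++ sFuel k R ++ [ n ]
sFuel-at k L n R eq q with firstMax-computed L n R eq q
... | max≡n , split≡ rewrite max≡n | split≡ = refl

sFuel-split : ∀ k L n R → AtFirstMax L n R → sFuel (suc k) (L ++ n ∷ R) ≡ sFuel k L ++ sFuel k R ++ [ n ]
sFuel-split k [] n R q = sFuel-at k [] n R refl q
sFuel-split k (l ∷ L) n R q = sFuel-at k (l ∷ L) n R refl q

sFuel-enough : ∀ π k → length π ≤ k → sFuel k π ≡ s π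
sFuel-enough π k bound = stable π k (length π) bound ≤-refl
  where
  Stable : List ℕ → Set
  Stable π = ∀ k k′ → length π ≤ k → length π ≤ k′ → sFuel k π ≡ sFuel k′ π
  step : ∀ L n R → AtFirstMax L n R → Stable L → Stable R → Stable (L ++ n ∷ R)
  step L n R q stableL stableR k k′ bound bound′
    with fuel-around L n R bound | fuel-around L n R bound′
  ... | a , refl , L≤a , R≤a | b , refl , L≤b , R≤b = begin
    sFuel (suc a) (L ++ n ∷ R)       ≡⟨ sFuel-split a L n R q ⟩
    sFuel a L ++ sFuel a R ++ [ n ]  ≡⟨ cong₂ (λ u v → u ++ v ++ [ n ]) (stableL a b L≤a L≤b) (stableR a b R≤a R≤b) ⟩
    sFuel b L ++ sFuel b R ++ [ n ]  ≡⟨ sym (sFuel-split b L n R q) ⟩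
    sFuel (suc b) (L ++ n ∷ R)       ∎
    where open ≡-Reasoning
  stable : ∀ π → Stable π
  stable = split-induction firstMax Stable (λ { k k′ _ _ → refl }) step

s-split : ∀ L n R → AtFirstMax L n R → s (L ++ n ∷ R) ≡ s L ++ s R ++ [ n ]
s-split L n R q = begin
  s (L ++ n ∷ R)                     ≡⟨ sym (sFuel-enough (L ++ n ∷ R) (suc k) (≤-reflexive (length-around L n R))) ⟩
  sFuel (suc k) (L ++ n ∷ R)         ≡⟨ sFuel-split k L n R q ⟩
  sFuel k L ++ sFuel k R ++ [ n ]    ≡⟨ cong₂ (λ u v → u ++ v ++ [ n ]) (sFuel-enough L k (m≤m+n _ _)) (sFuel-enough R k (m≤n+m _ _)) ⟩
  s L ++ s R ++ [ n ]                ∎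
  where
  open ≡-Reasoning
  k : ℕ
  k = length L + length R

-- f π is s π without its trailing right-to-left maxima:  f [] = [],  f(L n R) = s(L) f(R)
-- for n the first maximum.  It is the part of s(π 0) in front of a new minimal entry 0.
fFuel : ℕ → List ℕ → List ℕ
fFuel _ [] = []
fFuel zero (x ∷ xs) = []
fFuel (suc k) (x ∷ xs) with splitAt≡ (foldr _⊔_ x xs) (x ∷ xs)
... | L , R = sFuel k L ++ fFuel k R

f : List ℕ → List ℕ
f π = fFuel (length π) π

fFuel-at : ∀ k {x xs} L n R → x ∷ xs ≡ L ++ n ∷ R → AtFirstMax L n R →
  fFuel (suc k) (x ∷ xs) ≡ sFuel k L ++ fFuel k R
fFuel-at k L n R eq q with firstMax-computed L n R eq q
... | max≡n , split≡ rewrite max≡n | split≡ = refl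

fFuel-split : ∀ k L n R → AtFirstMax L n R → fFuel (suc k) (L ++ n ∷ R) ≡ sFuel k L ++ fFuel k R
fFuel-split k [] n R q = fFuel-at k [] n R refl q
fFuel-split k (l ∷ L) n R q = fFuel-at k (l ∷ L) n R refl q

fFuel-enough : ∀ π k → length π ≤ k → fFuel k π ≡ f π
fFuel-enough π k bound = stable π k (length π) bound ≤-refl
  where
  Stable : List ℕ → Set
  Stable π = ∀ k k′ → length π ≤ k → length π ≤ k′ → fFuel k π ≡ fFuel k′ π
  step : ∀ L n R → AtFirstMax L n R → Stable L → Stable R → Stable (L ++ n ∷ R)
  step L n R q _ stableR k k′ bound bound′
    with fuel-around L n R bound | fuel-around L n R bound′
  ... | a , refl , L≤a , R≤a | b , refl , L≤b , R≤b = begin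
    fFuel (suc a) (L ++ n ∷ R)  ≡⟨ fFuel-split a L n R q ⟩
    sFuel a L ++ fFuel a R      ≡⟨ cong₂ _++_ (trans (sFuel-enough L a L≤a) (sym (sFuel-enough L b L≤b))) (stableR a b R≤a R≤b) ⟩
    sFuel b L ++ fFuel b R      ≡⟨ sym (fFuel-split b L n R q) ⟩
    fFuel (suc b) (L ++ n ∷ R)  ∎
    where open ≡-Reasoning
  stable : ∀ π → Stable π
  stable = split-induction firstMax Stable (λ { k k′ _ _ → refl }) step

f-split : ∀ L n R → AtFirstMax L n R → f (L ++ n ∷ R) ≡ s L ++ f R
f-split L n R q = begin
  f (L ++ n ∷ R)              ≡⟨ sym (fFuel-enough (L ++ n ∷ R) (suc k) (≤-reflexive (length-around L n R))) ⟩
  fFuel (suc k) (L ++ n ∷ R)  ≡⟨ fFuel-split k L n R q ⟩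
  sFuel k L ++ fFuel k R      ≡⟨ cong₂ _++_ (sFuel-enough L k (m≤m+n _ _)) (fFuel-enough R k (m≤n+m _ _)) ⟩
  s L ++ f R                  ∎
  where
  open ≡-Reasoning
  k : ℕ
  k = length L + length R

s-↭ : ∀ π → s π ↭ π
s-↭ = split-induction firstMax (λ π → s π ↭ π) ↭-refl step
  where
  step : ∀ L n R → AtFirstMax L n R → s L ↭ L → s R ↭ R → s (L ++ n ∷ R) ↭ L ++ n ∷ R
  step L n R q sL↭L sR↭R = subst (_↭ L ++ n ∷ R) (sym (s-split L n R q))
    (↭-++⁺ sL↭L (↭-trans (++⁺ʳ [ n ] sR↭R) (++-comm R [ n ])))

f-deletes-around : ∀ L n R → AtFirstMax L n R → ∀ {T} → f R ++ T ↭ R →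
  f (L ++ n ∷ R) ++ n ∷ T ↭ L ++ n ∷ R
f-deletes-around L n R q {T} fR↭R = subst (λ u → u ++ n ∷ T ↭ L ++ n ∷ R) (sym (f-split L n R q))
  (subst (_↭ L ++ n ∷ R) (sym (++-assoc (s L) (f R) (n ∷ T)))
    (↭-++⁺ (s-↭ L) (↭-trans (shift n (f R) T) (prep n fR↭R))))

f-deletes : ∀ π → Σ (List ℕ) λ T → f π ++ T ↭ π
f-deletes = split-induction firstMax (λ π → Σ (List ℕ) λ T → f π ++ T ↭ π) ([] , ↭-refl)
  λ { L n R q _ (T , fR↭R) → n ∷ T , f-deletes-around L n R q fR↭R }

f-deletes-max : ∀ x xs → Σ ℕ λ top → Σ (List ℕ) λ T →
  f (x ∷ xs) ++ top ∷ T ↭ x ∷ xs × All (_≤ top) (x ∷ xs)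
f-deletes-max x xs with firstMax x xs
... | split L n R eq q@(L< , R≤) with f-deletes R
...   | T , fR↭R =
  n , T ,
  subst (λ π → f π ++ n ∷ T ↭ π) (sym eq) (f-deletes-around L n R q fR↭R) ,
  subst (All (_≤ n)) (sym eq) (bounded-around L R (All.map <⇒≤ L<) R≤)

f-shrinks : ∀ x xs → length (f (x ∷ xs)) < length (x ∷ xs)
f-shrinks x xs with f-deletes-max x xs
... | top , T , perm , _ = begin-strict
  length (f (x ∷ xs))                      <⟨ m<m+n _ z<s ⟩
  length (f (x ∷ xs)) + length (top ∷ T)   ≡⟨ sym (length-++ (f (x ∷ xs))) ⟩
  length (f (x ∷ xs) ++ top ∷ T)           ≡⟨ ↭-length perm ⟩
  length (x ∷ xs)                        ∎
  where open ≤-Reasoning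

s-All : ∀ {P : ℕ → Set} π → All P π → All P (s π)
s-All π = All-resp-↭ (↭-sym (s-↭ π))

f-All : ∀ {P : ℕ → Set} π → All P π → All P (f π)
f-All π Pπ with f-deletes π
... | T , perm = ++⁻ˡ (f π) (All-resp-↭ (↭-sym perm) Pπ)

unique-↭ : ∀ {xs ys : List ℕ} → xs ↭ ys → Unique xs → Unique ys
unique-↭ p = PermSetoid.Unique-resp-↭ (setoid ℕ) (↭⇒↭ₛ p)

unique-++ˡ : ∀ (xs : List ℕ) {ys} → Unique (xs ++ ys) → Unique xs
unique-++ˡ [] _ = []
unique-++ˡ (x ∷ xs) (x∉ ∷ u) = ++⁻ˡ xs x∉ ∷ unique-++ˡ xs u

unique-++ʳ : ∀ (xs : List ℕ) {ys} → Unique (xs ++ ys) → Unique ys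
unique-++ʳ [] u = u
unique-++ʳ (x ∷ xs) (_ ∷ u) = unique-++ʳ xs u

f-unique : ∀ π → Unique π → Unique (f π)
f-unique π u with f-deletes π
... | T , perm = unique-++ˡ (f π) (unique-↭ (↭-sym perm) u)

unique-≢-before : ∀ (L : List ℕ) n R → Unique (L ++ n ∷ R) → All (_≢ n) L
unique-≢-before [] n R _ = []
unique-≢-before (l ∷ L) n R (l∉ ∷ u) = All.head (++⁻ʳ L l∉) ∷ unique-≢-before L n R u

unique-≢-after : ∀ (L : List ℕ) n R → Unique (L ++ n ∷ R) → All (_≢ n) R
unique-≢-after L n R u with unique-++ʳ L u
... | n∉R ∷ _ = All.map (λ n≢r → n≢r ∘ sym) n∉R

strict-bound : ∀ {n} (xs : List ℕ) → All (_≤ n) xs → All (_≢ n) xs → All (_< n) xs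
strict-bound xs ≤n ≢n = All.zipWith (λ { (a≤n , a≢n) → ≤∧≢⇒< a≤n a≢n }) (≤n , ≢n)

Behind : ℕ → List ℕ → List ℕ → Set
Behind z A C = Σ (List ℕ) λ D → s (A ++ z ∷ C) ≡ f A ++ z ∷ D × All (z <_) D

behind-growˡ : ∀ {z} L n R C → AtFirstMax L n R → All (_≤ n) C → z < n →
  Behind z R C → Behind z (L ++ n ∷ R) C
behind-growˡ {z} L n R C q@(L< , R≤) C≤ z<n (D , eq , z<D) =
  D ++ [ n ] ,
  (begin
    s ((L ++ n ∷ R) ++ z ∷ C)          ≡⟨ cong s (++-assoc L (n ∷ R) (z ∷ C)) ⟩
    s (L ++ n ∷ R ++ z ∷ C)            ≡⟨ s-split L n (R ++ z ∷ C) (L< , ++⁺ R≤ (<⇒≤ z<n ∷ C≤)) ⟩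
    s L ++ s (R ++ z ∷ C) ++ [ n ]     ≡⟨ cong (λ u → s L ++ u ++ [ n ]) eq ⟩
    s L ++ (f R ++ z ∷ D) ++ [ n ]     ≡⟨ cong (s L ++_) (++-assoc (f R) (z ∷ D) [ n ]) ⟩
    s L ++ f R ++ z ∷ D ++ [ n ]       ≡⟨ sym (++-assoc (s L) (f R) _) ⟩
    (s L ++ f R) ++ z ∷ D ++ [ n ]     ≡⟨ cong (_++ z ∷ D ++ [ n ]) (sym (f-split L n R q)) ⟩
    f (L ++ n ∷ R) ++ z ∷ D ++ [ n ]   ∎) ,
  ++⁺ z<D (z<n ∷ [])
  where open ≡-Reasoning

behind-growʳ : ∀ {z} A L n R → AtFirstMax L n R → All (_< n) A → z < n → All (z <_) R →
  Behind z A L → Behind z A (L ++ n ∷ R)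
behind-growʳ {z} A L n R (L< , R≤) A< z<n z<R (D , eq , z<D) =
  D ++ s R ++ [ n ] ,
  (begin
    s (A ++ z ∷ L ++ n ∷ R)            ≡⟨ cong s (sym (++-assoc A (z ∷ L) (n ∷ R))) ⟩
    s ((A ++ z ∷ L) ++ n ∷ R)          ≡⟨ s-split (A ++ z ∷ L) n R (++⁺ A< (z<n ∷ L<) , R≤) ⟩
    s (A ++ z ∷ L) ++ s R ++ [ n ]     ≡⟨ cong (_++ s R ++ [ n ]) eq ⟩
    (f A ++ z ∷ D) ++ s R ++ [ n ]     ≡⟨ ++-assoc (f A) (z ∷ D) (s R ++ [ n ]) ⟩
    f A ++ z ∷ D ++ s R ++ [ n ]       ∎) ,
  ++⁺ z<D (++⁺ (s-All R z<R) (z<n ∷ []))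
  where open ≡-Reasoning

-- Lemma: if z is smaller than every entry of A and C then s(A z C) = f(A) z D with D > z.
-- Induction on A, and inside on C, always splitting off the larger of the two maxima.
s-behind-min : ∀ z A C → All (z <_) A → All (z <_) C → Behind z A C
s-behind-min z = split-induction firstMax Claim nil step
  where
  Claim : List ℕ → Set
  Claim A = ∀ C → All (z <_) A → All (z <_) C → Behind z A C

  nil : Claim []
  nil = split-induction firstMax (λ C → All (z <_) [] → All (z <_) C → Behind z [] C)
    (λ _ _ → [] , s-split [] z [] ([] , []) , [])
    λ { L n R q ihL _ _ z<C → let z<L , z<nR = ++⁻ L z<C in
          behind-growʳ [] L n R q [] (All.head z<nR) (All.tail z<nR) (ihL [] z<L) }

  step : ∀ L n R → AtFirstMax L n R → Claim L → Claim R → Claim (L ++ n ∷ R)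
  step L n R q@(L< , R≤) _ ihR = split-induction firstMax ClaimC
    (λ z<A _ → behind-growˡ L n R [] q [] (z<n z<A) (ihR [] (z<R z<A) []))
    stepC
    where
    A : List ℕ
    A = L ++ n ∷ R
    ClaimC : List ℕ → Set
    ClaimC C = All (z <_) A → All (z <_) C → Behind z A C
    z<n : All (z <_) A → z < n
    z<n z<A = All.head (++⁻ʳ L z<A)
    z<R : All (z <_) A → All (z <_) R
    z<R z<A = All.tail (++⁻ʳ L z<A)
    stepC : ∀ L′ c R′ → AtFirstMax L′ c R′ → ClaimC L′ → ClaimC R′ → ClaimC (L′ ++ c ∷ R′)
    stepC L′ c R′ q′@(L′< , R′≤) ihL′ _ z<A z<C with c ≤? n
    ... | yes c≤n = behind-growˡ L n R (L′ ++ c ∷ R′) q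
          (All.map (λ p → ≤-trans p c≤n) (bounded-around L′ R′ (All.map <⇒≤ L′<) R′≤))
          (z<n z<A) (ihR _ (z<R z<A) z<C)
    ... | no c≰n = behind-growʳ A L′ c R′ q′
          (All.map (λ p → ≤-<-trans p (≰⇒> c≰n)) (bounded-around L R (All.map <⇒≤ L<) R≤))
          (All.head (++⁻ʳ L′ z<C)) (All.tail (++⁻ʳ L′ z<C)) (ihL′ z<A (++⁻ˡ L′ z<C))

fIter : ℕ → List ℕ → List ℕ
fIter zero π = π
fIter (suc t) π = f (fIter t π)

fIter-All : ∀ {P : ℕ → Set} t π → All P π → All P (fIter t π)
fIter-All zero π Pπ = Pπ
fIter-All (suc t) π Pπ = f-All (fIter t π) (fIter-All t π Pπ)

sIter-behind-min : ∀ z t π → All (z <_) π →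
  Σ (List ℕ) λ D → sIter t (π ++ [ z ]) ≡ fIter t π ++ z ∷ D × All (z <_) D
sIter-behind-min z zero π _ = [] , refl , []
sIter-behind-min z (suc t) π z<π with sIter-behind-min z t π z<π
... | D , eq , z<D with s-behind-min z (fIter t π) D (fIter-All t π z<π) z<D
...   | D′ , eq′ , z<D′ = D′ , trans (cong s eq) eq′ , z<D′

zero-first : ∀ t π → All (0 <_) π → fIter t π ≡ [] → head (sIter t (π ++ [ 0 ])) ≡ just 0
zero-first t π 0<π done with sIter-behind-min 0 t π 0<π
... | D , eq , _ rewrite eq | done = refl

fIter-suc : ∀ t π → fIter (suc t) π ≡ fIter t (f π)
fIter-suc zero π = refl
fIter-suc (suc t) π = cong f (fIter-suc t π)

fIter-clears-short : ∀ t π → length π ≤ t → fIter t π ≡ []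
fIter-clears-short zero [] _ = refl
fIter-clears-short (suc t) [] _ = cong f (fIter-clears-short t [] z≤n)
fIter-clears-short (suc t) (x ∷ xs) (s≤s bound) =
  trans (fIter-suc t (x ∷ xs)) (fIter-clears-short t (f (x ∷ xs)) (s≤s⁻¹ (≤-trans (f-shrinks x xs) (s≤s bound))))

module _ {P : ℕ → Set} (P? : Decidable P) where

  count-++ : ∀ xs ys → length (filter P? (xs ++ ys)) ≡ length (filter P? xs) + length (filter P? ys)
  count-++ xs ys = trans (cong length (filter-++ P? xs ys)) (length-++ (filter P? xs))

  count-↭ : ∀ {xs ys} → xs ↭ ys → length (filter P? xs) ≡ length (filter P? ys)
  count-↭ p = ↭-length (filter-↭ P? p)

#≥ : ℕ → List ℕ → ℕ
#≥ v xs = length (filter (v ≤?_) xs)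

#> : ℕ → List ℕ → ℕ
#> v xs = length (filter (v <?_) xs)

-- Y dominates Z if for every threshold v, Z has at most as many entries ≥ v as Y has > v.
-- This is an order-free form of quarantine (see quarantined⇒dominates).
Dominates : List ℕ → List ℕ → Set
Dominates Y Z = ∀ v → #≥ v Z ≤ #> v Y

#>-single : ∀ v y → #> v [ y ] ≤ 1
#>-single v y = length-filter (v <?_) [ y ]

#≥0-empty : ∀ Z → #≥ 0 Z ≤ 0 → Z ≡ []
#≥0-empty [] _ = refl
#≥0-empty (z ∷ Z) bound
  with subst (_≤ 0) (cong length (filter-all (0 ≤?_) (All.universal (λ _ → z≤n) (z ∷ Z)))) bound
... | ()

-- If Y dominates Z and y bounds Y, then y strictly bounds Z: an entry z ≥ y of Z
-- would be counted by #≥ z Z, while Y has no entry > z.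
dominated-below : ∀ {y} Y Z → Dominates Y Z → All (_≤ y) Y → All (_< y) Z
dominated-below {y} Y Z dom Y≤y = All.tabulate below
  where
  below : ∀ {z} → z ∈ Z → z < y
  below {z} z∈Z with z <? y
  ... | yes z<y = z<y
  ... | no z≮y = ⊥-elim (n≮0 (begin-strict
    0        <⟨ filter-some (z ≤?_) (Any.map (λ { refl → ≤-refl }) z∈Z) ⟩
    #≥ z Z   ≤⟨ dom z ⟩
    #> z Y   ≡⟨ cong length (filter-none (z <?_) (All.map (λ a≤y z<a → z≮y (<-≤-trans z<a a≤y)) Y≤y)) ⟩
    0        ∎))
    where open ≤-Reasoning

-- Deleting (at least) the maximum, f costs Z one entry above every threshold it is
-- counted at: if Ym ++ [ y ] dominates Z, then Ym dominates f Z.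
f-dominated : ∀ Ym y Z → Dominates (Ym ++ [ y ]) Z → Dominates Ym (f Z)
f-dominated Ym y [] dom v = z≤n
f-dominated Ym y (z ∷ Z) dom v with f-deletes-max z Z
... | top , T , perm , Z≤top with v ≤? top
...   | no v≰top = ≤-trans (≤-reflexive (cong length (filter-none (v ≤?_) fZ<v))) z≤n
  where
  fZ<v : All (λ a → ¬ v ≤ a) (f (z ∷ Z))
  fZ<v = f-All (z ∷ Z) (All.map (λ a≤top v≤a → v≰top (≤-trans v≤a a≤top)) Z≤top)
...   | yes v≤top = +-cancelʳ-≤ 1 _ _ (begin
  #≥ v (f (z ∷ Z)) + 1                    ≤⟨ +-monoʳ-≤ (#≥ v (f (z ∷ Z))) top-counted ⟩
  #≥ v (f (z ∷ Z)) + #≥ v (top ∷ T)       ≡⟨ sym (count-++ (v ≤?_) (f (z ∷ Z)) (top ∷ T)) ⟩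
  #≥ v (f (z ∷ Z) ++ top ∷ T)             ≡⟨ count-↭ (v ≤?_) perm ⟩
  #≥ v (z ∷ Z)                            ≤⟨ dom v ⟩
  #> v (Ym ++ [ y ])                      ≡⟨ count-++ (v <?_) Ym [ y ] ⟩
  #> v Ym + #> v [ y ]                    ≤⟨ +-monoʳ-≤ (#> v Ym) (#>-single v y) ⟩
  #> v Ym + 1                             ∎)
  where
  open ≤-Reasoning
  top-counted : 1 ≤ #≥ v (top ∷ T)
  top-counted = subst (1 ≤_) (sym (cong length (filter-accept (v ≤?_) v≤top))) (s≤s z≤n)

Desc : List ℕ → Set
Desc = AllPairs (λ a b → b ≤ a)

reverse-desc : ∀ xs → AllPairs _≤_ xs → Desc (reverse xs)
reverse-desc [] _ = []
reverse-desc (x ∷ xs) (x≤ ∷ asc) rewrite unfold-reverse x xs =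
  AllPairs.++⁺ (reverse-desc xs asc) ([] ∷ [])
    (All.map (λ x≤a → x≤a ∷ []) (All-resp-↭ (↭-sym (↭-reverse xs)) x≤))

sortDesc-↭ : ∀ X → sortDesc X ↭ X
sortDesc-↭ X = ↭-trans (↭-reverse _) (InsertionSort.sort-↭ ≤-decTotalOrder X)

sortDesc-desc : ∀ X → Desc (sortDesc X)
sortDesc-desc X = reverse-desc _ (Linked⇒AllPairs ≤-trans (InsertionSort.sort-↗ ≤-decTotalOrder X))

all-at : ∀ {P : ℕ → Set} S j → All P S → j < length S → P (at S j)
all-at (x ∷ S) zero (px ∷ _) _ = px
all-at (x ∷ S) (suc j) (_ ∷ pS) (s≤s j<) = all-at S j pS j<

desc-≥ : ∀ S v j → Desc S → j < #≥ v S → v ≤ at S j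
desc-≥ (x ∷ S) v j (x≥ ∷ desc) j< with v ≤? x
... | no v≰x = ⊥-elim (n≮0 (subst (j <_) none j<))
  where
  none : #≥ v (x ∷ S) ≡ 0
  none = cong length (trans (filter-reject (v ≤?_) v≰x)
           (filter-none (v ≤?_) (All.map (λ a≤x v≤a → v≰x (≤-trans v≤a a≤x)) x≥)))
... | yes v≤x with j
...   | zero = v≤x
...   | suc j′ = desc-≥ S v j′ desc (s≤s⁻¹ (subst (suc j′ <_) (cong length (filter-accept (v ≤?_) v≤x)) j<))

desc-> : ∀ S v j → Desc S → j < length S → v < at S j → suc j ≤ #> v S
desc-> (x ∷ S) v zero _ _ v<x = subst (1 ≤_) (sym (cong length (filter-accept (v <?_) v<x))) (s≤s z≤n)
desc-> (x ∷ S) v (suc j) (x≥ ∷ desc) (s≤s j<) v<Sj =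
  subst (suc (suc j) ≤_) (sym (cong length (filter-accept (v <?_) (<-≤-trans v<Sj (all-at S j x≥ j<)))))
    (s≤s (desc-> S v j desc j< v<Sj))

-- Quarantine implies domination: if c entries of E are ≥ v, the c-th largest of E is ≥ v,
-- so the c-th largest of B is > v, and so are the c largest entries of B.
quarantined⇒dominates : ∀ B E → Quarantined B E → Dominates B E
quarantined⇒dominates B E (|E|≤|B| , larger) v with #≥ v E in count≡
... | zero = z≤n
... | suc c = begin
  suc c             ≤⟨ desc-> SB v c (sortDesc-desc B) c<|SB| v<SB[c] ⟩
  #> v SB           ≡⟨ count-↭ (v <?_) (sortDesc-↭ B) ⟩
  #> v B            ∎
  where
  open ≤-Reasoning
  SE SB : List ℕ
  SE = sortDesc E
  SB = sortDesc B
  c<|E| : c < length E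
  c<|E| = subst (_≤ length E) count≡ (length-filter (v ≤?_) E)
  c<|SB| : c < length SB
  c<|SB| = subst (c <_) (sym (↭-length (sortDesc-↭ B))) (≤-trans c<|E| |E|≤|B|)
  v≤SE[c] : v ≤ at SE c
  v≤SE[c] = desc-≥ SE v c (sortDesc-desc E) (subst (c <_) (sym (trans (count-↭ (v ≤?_) (sortDesc-↭ E)) count≡)) ≤-refl)
  v<SB[c] : v < at SB c
  v<SB[c] = ≤-<-trans v≤SE[c] (larger (suc c) (s≤s z≤n) c<|E|)

snoc-regroup : ∀ (X Ym : List ℕ) y Z → X ++ (Ym ++ [ y ]) ++ Z ≡ (X ++ Ym) ++ y ∷ Z
snoc-regroup X Ym y Z = trans (cong (X ++_) (++-assoc Ym [ y ] Z)) (sym (++-assoc X Ym (y ∷ Z)))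

data Guarded : List ℕ → List ℕ → Set where
  empty  : Guarded [] []
  topped : ∀ {Ym y Z} → All (_< y) Ym → Dominates (Ym ++ [ y ]) Z → Guarded (Ym ++ [ y ]) Z

-- If V has at least as many entries above each threshold as Ym, and Ym ++ [ y ] dominates Z,
-- then s V is guarded over f Z: s V ends with the maximum of V, and f Z lost its maximum.
s-guarded : ∀ V Ym y Z → (∀ v → #> v Ym ≤ #> v V) → Unique V →
  Dominates (Ym ++ [ y ]) Z → Guarded (s V) (f Z)
s-guarded [] Ym y Z more _ dom
  rewrite #≥0-empty (f Z) (≤-trans (f-dominated Ym y Z dom 0) (more 0)) = empty
s-guarded (x ∷ V) Ym y Z more u dom with firstMax x V
... | split L n R eq q@(L< , R≤) =
  subst (λ W → Guarded W (f Z)) (sym sV≡)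
    (topped (++⁺ (s-All L L<) (s-All R R<n)) (subst (λ W → Dominates W (f Z)) sV≡ dominates))
  where
  sV≡ : s (x ∷ V) ≡ (s L ++ s R) ++ [ n ]
  sV≡ = trans (cong s eq) (trans (s-split L n R q) (sym (++-assoc (s L) (s R) [ n ])))
  R<n : All (_< n) R
  R<n = strict-bound R R≤ (unique-≢-after L n R (subst Unique eq u))
  dominates : Dominates (s (x ∷ V)) (f Z)
  dominates v = ≤-trans (f-dominated Ym y Z dom v)
    (≤-trans (more v) (≤-reflexive (count-↭ (v <?_) (↭-sym (s-↭ (x ∷ V))))))

record Stepped (X Ym : List ℕ) (y : ℕ) (Z : List ℕ) : Set where
  constructor stepped
  field
    X′ Y′   : List ℕ
    shape   : f (X ++ (Ym ++ [ y ]) ++ Z) ≡ X′ ++ Y′ ++ f Z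
    guarded : Guarded Y′ (f Z)
    shorter : length X′ + length Y′ ≤ length X + length Ym

module _ (Ym : List ℕ) (y : ℕ) (Z : List ℕ) (Ym<y : All (_< y) Ym) (dom : Dominates (Ym ++ [ y ]) Z) where

  Z<y : All (_< y) Z
  Z<y = dominated-below (Ym ++ [ y ]) Z dom (++⁺ (All.map <⇒≤ Ym<y) (≤-refl ∷ []))

  -- If all of X is below y, then y is the first maximum, so f(X Y Z) = s(X Ym) f(Z).
  f-step-below : ∀ X → All (_< y) X → Unique (X ++ (Ym ++ [ y ]) ++ Z) → Stepped X Ym y Z
  f-step-below X X<y u =
    stepped [] (s (X ++ Ym))
      (trans (cong f (snoc-regroup X Ym y Z)) (f-split (X ++ Ym) y Z (++⁺ X<y Ym<y , All.map <⇒≤ Z<y)))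
      (s-guarded (X ++ Ym) Ym y Z more (unique-++ˡ (X ++ Ym) (subst Unique (snoc-regroup X Ym y Z) u)) dom)
      (≤-reflexive (trans (↭-length (s-↭ (X ++ Ym))) (length-++ X)))
    where
    more : ∀ v → #> v Ym ≤ #> v (X ++ Ym)
    more v = ≤-trans (m≤n+m _ _) (≤-reflexive (sym (count-++ (v <?_) X Ym)))

  -- Otherwise X = L n R with n ≥ y its first maximum, so f(X Y Z) = s(L) f(R Y Z).
  f-step : ∀ X → Unique (X ++ (Ym ++ [ y ]) ++ Z) → Stepped X Ym y Z
  f-step = split-induction firstMax Claim (f-step-below [] []) step
    where
    Claim : List ℕ → Set
    Claim X = Unique (X ++ (Ym ++ [ y ]) ++ Z) → Stepped X Ym y Z
    step : ∀ L n R → AtFirstMax L n R → Claim L → Claim R → Claim (L ++ n ∷ R)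
    step L n R q@(L< , R≤) _ ihR u with n <? y
    ... | yes n<y = f-step-below (L ++ n ∷ R)
          (All.map (λ a≤n → ≤-<-trans a≤n n<y) (bounded-around L R (All.map <⇒≤ L<) R≤)) u
    ... | no n≮y = extend (ihR (unique-++ʳ (L ++ [ n ]) (subst Unique regroup u)))
      where
      regroup : (L ++ n ∷ R) ++ (Ym ++ [ y ]) ++ Z ≡ (L ++ [ n ]) ++ R ++ (Ym ++ [ y ]) ++ Z
      regroup = trans (++-assoc L (n ∷ R) _) (sym (++-assoc L [ n ] _))
      y≤n : y ≤ n
      y≤n = ≮⇒≥ n≮y
      extend : Stepped R Ym y Z → Stepped (L ++ n ∷ R) Ym y Z
      extend (stepped X″ Y′ shape guarded shorter) = stepped (s L ++ X″) Y′ shape′ guarded shorter′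
        where
        rest≤n : All (_≤ n) (R ++ (Ym ++ [ y ]) ++ Z)
        rest≤n = ++⁺ R≤ (All.map (λ a≤y → ≤-trans a≤y y≤n)
                   (++⁺ (++⁺ (All.map <⇒≤ Ym<y) (≤-refl ∷ [])) (All.map <⇒≤ Z<y)))
        shape′ : f ((L ++ n ∷ R) ++ (Ym ++ [ y ]) ++ Z) ≡ (s L ++ X″) ++ Y′ ++ f Z
        shape′ = begin
          f ((L ++ n ∷ R) ++ (Ym ++ [ y ]) ++ Z)   ≡⟨ cong f (++-assoc L (n ∷ R) _) ⟩
          f (L ++ n ∷ R ++ (Ym ++ [ y ]) ++ Z)     ≡⟨ f-split L n _ (L< , rest≤n) ⟩
          s L ++ f (R ++ (Ym ++ [ y ]) ++ Z)       ≡⟨ cong (s L ++_) shape ⟩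
          s L ++ X″ ++ Y′ ++ f Z                   ≡⟨ sym (++-assoc (s L) X″ _) ⟩
          (s L ++ X″) ++ Y′ ++ f Z                 ∎
          where open ≡-Reasoning
        shorter′ : length (s L ++ X″) + length Y′ ≤ length (L ++ n ∷ R) + length Ym
        shorter′ = begin
          length (s L ++ X″) + length Y′           ≡⟨ cong (_+ length Y′) (length-++ (s L)) ⟩
          (length (s L) + length X″) + length Y′   ≡⟨ +-assoc (length (s L)) _ _ ⟩
          length (s L) + (length X″ + length Y′)   ≤⟨ +-mono-≤ (≤-reflexive (↭-length (s-↭ L))) shorter ⟩
          length L + (length R + length Ym)        ≡⟨ sym (+-assoc (length L) _ _) ⟩
          (length L + length R) + length Ym        ≤⟨ +-monoˡ-≤ (length Ym) (≤-trans (n≤1+n _) (≤-reflexive (sym (length-around L n R)))) ⟩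
          length (L ++ n ∷ R) + length Ym          ∎
          where open ≤-Reasoning

length-snoc : ∀ (X Ym : List ℕ) y → length X + length (Ym ++ [ y ]) ≡ suc (length X + length Ym)
length-snoc X Ym y = begin
  length X + length (Ym ++ [ y ])   ≡⟨ cong (length X +_) (trans (length-++ Ym) (+-comm _ 1)) ⟩
  length X + suc (length Ym)        ≡⟨ +-suc (length X) (length Ym) ⟩
  suc (length X + length Ym)        ∎
  where open ≡-Reasoning

-- Main lemma: if Y is guarded over Z then f^t(X Y Z) = [] for every t ≥ |X| + |Y|.
-- Each application of f keeps the shape X′ Y′ Z′ and shortens X′ Y′ by at least one.
fIter-clears : ∀ t X Y Z → Guarded Y Z → Unique (X ++ Y ++ Z) → length X + length Y ≤ t →
  fIter t (X ++ Y ++ Z) ≡ []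
fIter-clears t X .[] .[] empty _ bound =
  fIter-clears-short t (X ++ []) (subst (_≤ t) (sym (length-++ X)) bound)
fIter-clears zero X .(Ym ++ [ y ]) Z (topped {Ym} {y} _ _) _ bound
  with subst (_≤ 0) (length-snoc X Ym y) bound
... | ()
fIter-clears (suc t) X .(Ym ++ [ y ]) Z (topped {Ym} {y} Ym<y dom) u bound
  with f-step Ym y Z Ym<y dom X u
... | stepped X′ Y′ shape guarded shorter = begin
  fIter (suc t) (X ++ (Ym ++ [ y ]) ++ Z)   ≡⟨ fIter-suc t _ ⟩
  fIter t (f (X ++ (Ym ++ [ y ]) ++ Z))     ≡⟨ cong (fIter t) shape ⟩
  fIter t (X′ ++ Y′ ++ f Z)                 ≡⟨ fIter-clears t X′ Y′ (f Z) guarded (subst Unique shape (f-unique _ u)) bound′ ⟩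
  []                                        ∎
  where
  open ≡-Reasoning
  bound′ : length X′ + length Y′ ≤ t
  bound′ = ≤-trans shorter (s≤s⁻¹ (subst (_≤ suc t) (length-snoc X Ym y) bound))

rlPosFrom-shift : ∀ k j xs → rlPosFrom (k + j) xs ≡ map (k +_) (rlPosFrom j xs)
rlPosFrom-shift k j [] = refl
rlPosFrom-shift k j (x ∷ xs) with ⌊ all? (_<? x) xs ⌋
... | true = cong₂ _∷_ (sym (+-suc k j)) (trans (cong (λ o → rlPosFrom o xs) (sym (+-suc k j))) (rlPosFrom-shift k (suc j) xs))
... | false = trans (cong (λ o → rlPosFrom o xs) (sym (+-suc k j))) (rlPosFrom-shift k (suc j) xs)

rlPosFrom-around : ∀ k L n R → AtLastMax L n R →
  rlPosFrom k (L ++ n ∷ R) ≡ suc (k + length L) ∷ rlPosFrom (suc (k + length L)) R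
rlPosFrom-around k [] n R (_ , R<) with all? (_<? n) R
... | yes _ rewrite +-identityʳ k = refl
... | no not-all = ⊥-elim (not-all R<)
rlPosFrom-around k (l ∷ L) n R (l≤n ∷ L≤ , R<) with all? (_<? l) (L ++ n ∷ R)
... | yes all< = ⊥-elim (<⇒≱ (All.head (++⁻ʳ L all<)) l≤n)
... | no _ rewrite rlPosFrom-around (suc k) L n R (L≤ , R<) | +-suc k (length L) = refl

at-map : ∀ (g : ℕ → ℕ) xs j → j < length xs → at (map g xs) j ≡ g (at xs j)
at-map g (x ∷ xs) zero _ = refl
at-map g (x ∷ xs) (suc j) (s≤s j<) = at-map g xs j j<

at-beyond : ∀ xs j → length xs ≤ j → at xs j ≡ 0
at-beyond [] j _ = refl
at-beyond (x ∷ xs) (suc j) (s≤s bound) = at-beyond xs j bound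

take-prefix : ∀ (P Q : List ℕ) b → take (length P + b) (P ++ Q) ≡ P ++ take b Q
take-prefix [] Q b = refl
take-prefix (p ∷ P) Q b = cong (p ∷_) (take-prefix P Q b)

drop-prefix : ∀ (P Q : List ℕ) a → drop (length P + a) (P ++ Q) ≡ drop a Q
drop-prefix [] Q a = refl
drop-prefix (p ∷ P) Q a = drop-prefix P Q a

Eset-peel : ∀ π k → numRL π ≡ suc k → Eset π 0 ≡ block π 1 ++ Eset π 1
Eset-peel π k r≡ rewrite r≡ =
  cong (block π 1 ++_) (cong concat (trans (map-applyUpTo suc _ k) (sym (map-applyUpTo id _ k))))

-- The blocks of π = L ++ n ∷ R, split at its last maximum n:
-- B₁(π) = L ++ [ n ], and B_{ℓ+1}(π) = B_ℓ(R) (positions shifted by c = |L| + 1).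
module AroundLastMax (L : List ℕ) (n : ℕ) (R : List ℕ) (q : AtLastMax L n R) where

  π : List ℕ
  π = L ++ n ∷ R

  c : ℕ
  c = suc (length L)

  P : List ℕ
  P = L ++ [ n ]

  length-P : length P ≡ c
  length-P = trans (length-++ L) (+-comm (length L) 1)

  π≡ : π ≡ P ++ R
  π≡ = sym (++-assoc L [ n ] R)

  rlPos≡ : rlPos π ≡ c ∷ map (c +_) (rlPos R)
  rlPos≡ = trans (rlPosFrom-around 0 L n R q)
    (cong (c ∷_) (trans (cong (λ o → rlPosFrom o R) (sym (+-identityʳ c))) (rlPosFrom-shift c 0 R)))

  numRL≡ : numRL π ≡ suc (numRL R)
  numRL≡ = trans (cong length rlPos≡) (cong suc (length-map (c +_) (rlPos R)))

  idx-first : idx π 1 ≡ c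
  idx-first = cong (λ ps → at ps 0) rlPos≡

  idx-later : ∀ ℓ → ℓ ≤ numRL R → idx π (suc ℓ) ≡ c + idx R ℓ
  idx-later zero _ = trans idx-first (sym (+-identityʳ c))
  idx-later (suc ℓ) ℓ< = trans (cong (λ ps → at ps (suc ℓ)) rlPos≡) (at-map (c +_) (rlPos R) ℓ ℓ<)

  idx-beyond : ∀ ℓ → numRL R ≤ ℓ → idx π (suc (suc ℓ)) ≡ 0
  idx-beyond ℓ r≤ℓ = trans (cong (λ ps → at ps (suc ℓ)) rlPos≡)
    (at-beyond (map (c +_) (rlPos R)) ℓ (subst (_≤ ℓ) (sym (length-map (c +_) (rlPos R))) r≤ℓ))

  block-first : block π 1 ≡ P
  block-first = begin
    take (idx π 1) π              ≡⟨ cong₂ take (trans idx-first (sym (trans (+-identityʳ _) length-P))) π≡ ⟩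
    take (length P + 0) (P ++ R)  ≡⟨ take-prefix P R 0 ⟩
    P ++ []                       ≡⟨ ++-assoc L [ n ] [] ⟩
    P                             ∎
    where open ≡-Reasoning

  block-later : ∀ ℓ → block π (suc (suc ℓ)) ≡ block R (suc ℓ)
  block-later ℓ with suc ℓ ≤? numRL R
  ... | yes ℓ<r = begin
    drop (idx π (suc ℓ)) (take (idx π (suc (suc ℓ))) π)
      ≡⟨ cong₂ (λ a b → drop a (take b π)) (idx-later ℓ (≤-trans (n≤1+n ℓ) ℓ<r)) (idx-later (suc ℓ) ℓ<r) ⟩
    drop (c + idx R ℓ) (take (c + idx R (suc ℓ)) π)
      ≡⟨ cong₂ (λ a W → drop (a + idx R ℓ) (take (a + idx R (suc ℓ)) W)) (sym length-P) π≡ ⟩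
    drop (length P + idx R ℓ) (take (length P + idx R (suc ℓ)) (P ++ R))
      ≡⟨ cong (drop (length P + idx R ℓ)) (take-prefix P R _) ⟩
    drop (length P + idx R ℓ) (P ++ take (idx R (suc ℓ)) R)
      ≡⟨ drop-prefix P _ _ ⟩
    block R (suc ℓ) ∎
    where open ≡-Reasoning
  ... | no ℓ≮r = begin
    drop (idx π (suc ℓ)) (take (idx π (suc (suc ℓ))) π)   ≡⟨ cong (λ b → drop (idx π (suc ℓ)) (take b π)) (idx-beyond ℓ r≤ℓ) ⟩
    drop (idx π (suc ℓ)) []                               ≡⟨ drop-[] (idx π (suc ℓ)) ⟩
    []                                                    ≡⟨ sym (drop-[] (idx R ℓ)) ⟩
    drop (idx R ℓ) []                                     ≡⟨ cong (λ b → drop (idx R ℓ) (take b R)) (sym (at-beyond (rlPos R) ℓ r≤ℓ)) ⟩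
    block R (suc ℓ)                                       ∎
    where
    open ≡-Reasoning
    r≤ℓ : numRL R ≤ ℓ
    r≤ℓ = s≤s⁻¹ (≰⇒> ℓ≮r)

  Eset-later : ∀ m → Eset π (suc m) ≡ Eset R m
  Eset-later m = cong concat (trans
    (cong (λ r → map (λ j → block π (suc (suc m) + j)) (upTo (r ∸ suc m))) numRL≡)
    (map-cong (λ j → block-later (m + j)) (upTo (numRL R ∸ m))))

Eset-all : ∀ π → Eset π 0 ≡ π
Eset-all = split-induction lastMax (λ π → Eset π 0 ≡ π) refl step
  where
  step : ∀ L n R → AtLastMax L n R → Eset L 0 ≡ L → Eset R 0 ≡ R → Eset (L ++ n ∷ R) 0 ≡ L ++ n ∷ R
  step L n R q _ E₀R≡R = begin
    Eset π 0              ≡⟨ Eset-peel π (numRL R) numRL≡ ⟩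
    block π 1 ++ Eset π 1 ≡⟨ cong₂ _++_ block-first (trans (Eset-later 0) E₀R≡R) ⟩
    P ++ R                ≡⟨ sym π≡ ⟩
    π                     ∎
    where
    open ≡-Reasoning
    open AroundLastMax L n R q

record BlockSplit (π : List ℕ) (m : ℕ) : Set where
  constructor blockSplit
  field
    X Bm     : List ℕ
    b        : ℕ
    shape    : π ≡ X ++ (Bm ++ [ b ]) ++ Eset π m
    block≡   : block π m ≡ Bm ++ [ b ]
    Bm≤b     : All (_≤ b) Bm
    position : length X + length (Bm ++ [ b ]) ≡ idx π m

block-split : ∀ π m → 1 ≤ m → m ≤ numRL π → BlockSplit π m
block-split = split-induction lastMax Claim (λ { zero () _ ; (suc m) _ () }) step
  where
  Claim : List ℕ → Set
  Claim π = ∀ m → 1 ≤ m → m ≤ numRL π → BlockSplit π m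
  step : ∀ L n R → AtLastMax L n R → Claim L → Claim R → Claim (L ++ n ∷ R)
  step L n R q@(L≤ , _) _ ihR (suc zero) _ _ =
    blockSplit [] L n
      (trans π≡ (cong (P ++_) (sym (trans (Eset-later 0) (Eset-all R)))))
      block-first L≤
      (trans length-P (sym idx-first))
    where open AroundLastMax L n R q
  step L n R q _ ihR (suc (suc m)) _ m<r = extend (ihR (suc m) (s≤s z≤n) m<numRL-R)
    where
    open AroundLastMax L n R q
    m<numRL-R : suc m ≤ numRL R
    m<numRL-R = s≤s⁻¹ (subst (suc (suc m) ≤_) numRL≡ m<r)
    extend : BlockSplit R (suc m) → BlockSplit π (suc (suc m))
    extend (blockSplit X Bm b shape block≡ Bm≤b position) =
      blockSplit (P ++ X) Bm b shape′ (trans (block-later m) block≡) Bm≤b position′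
      where
      shape′ : π ≡ (P ++ X) ++ (Bm ++ [ b ]) ++ Eset π (suc (suc m))
      shape′ = begin
        π                                                 ≡⟨ π≡ ⟩
        P ++ R                                            ≡⟨ cong (P ++_) shape ⟩
        P ++ X ++ (Bm ++ [ b ]) ++ Eset R (suc m)         ≡⟨ cong (λ E → P ++ X ++ (Bm ++ [ b ]) ++ E) (sym (Eset-later (suc m))) ⟩
        P ++ X ++ (Bm ++ [ b ]) ++ Eset π (suc (suc m))   ≡⟨ sym (++-assoc P X _) ⟩
        (P ++ X) ++ (Bm ++ [ b ]) ++ Eset π (suc (suc m)) ∎
        where open ≡-Reasoning
      position′ : length (P ++ X) + length (Bm ++ [ b ]) ≡ idx π (suc (suc m))
      position′ = begin
        length (P ++ X) + length (Bm ++ [ b ])       ≡⟨ cong (_+ length (Bm ++ [ b ])) (length-++ P) ⟩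
        (length P + length X) + length (Bm ++ [ b ]) ≡⟨ +-assoc (length P) _ _ ⟩
        length P + (length X + length (Bm ++ [ b ])) ≡⟨ cong₂ _+_ length-P position ⟩
        c + idx R (suc m)                            ≡⟨ sym (idx-later (suc m) m<numRL-R) ⟩
        idx π (suc (suc m))                          ∎
        where open ≡-Reasoning

lemma2p10 : (π : List ℕ) → Unique π → All (λ x → 0 < x) π →
    (m : ℕ) → 1 ≤ m → m < numRL π →
    Quarantined (block π m) (Eset π m) →
    Σ ℕ (λ t → 1 ≤ t × t ≤ idx π m × head (sIter t (π ++ [ 0 ])) ≡ just 0)
lemma2p10 π u 0<π m 1≤m m<r quarantined with block-split π m 1≤m (<⇒≤ m<r)
... | blockSplit X Bm b shape block≡ Bm≤b position =
  idx π m , 1≤i , ≤-refl , zero-first (idx π m) π 0<π cleared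
  where
  B E : List ℕ
  B = Bm ++ [ b ]
  E = Eset π m
  dominates : Dominates B E
  dominates = subst (λ B′ → Dominates B′ E) block≡ (quarantined⇒dominates (block π m) E quarantined)
  Bm<b : All (_< b) Bm
  Bm<b = strict-bound Bm Bm≤b (++⁻ʳ X (unique-≢-before (X ++ Bm) b E (subst Unique (trans shape (snoc-regroup X Bm b E)) u)))
  cleared : fIter (idx π m) π ≡ []
  cleared = subst (λ W → fIter (idx π m) W ≡ []) (sym shape)
    (fIter-clears (idx π m) X B E (topped Bm<b dominates) (subst Unique shape u) (≤-reflexive position))
  1≤i : 1 ≤ idx π m
  1≤i = subst (1 ≤_) (trans (sym (length-snoc X Bm b)) position) (s≤s z≤n)
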